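{- Let $n \geq 0$ and $i \geq 2$ be integers. Then $\dim_{\mathbb{F}_2} \mathrm{Gov}(V_{[n]}, i) = (i - 1) \binom{n}{i}$.
   Context: $[n] = \{1,\dots,n\}$; $V_{[n]} = \mathbb{F}_2^{[n]}$ with standard basis $(e_h)_{h\in[n]}$ and dual functionals $\chi_h$ ($\chi_h(e_{h'}) = \delta_{h,h'}$). For linear functionals $\lambda_1,\dots,\lambda_i$ on $V_{[n]}$, $\lambda_1 \otimes \dots \otimes \lambda_i$ is the multilinear map $(\sigma_1,\dots,\sigma_i) \mapsto \prod_h \lambda_h(\sigma_h)$ on $V_{[n]}^i$. For $A \subseteq [n]$ with $\#A = i \geq 2$ and $x \in A$, the governing tensor is $$\phi_{(A,x)} = \sum_{\tau} \chi_{\tau(1)} \otimes \dots \otimes \chi_{\tau(i)},$$ the sum over bijections $\tau: [i] \to A$ with $\tau(i-1) = x$ or $\tau(i) = x$. $\mathrm{Gov}(V_{[n]}, i)$ is the $\mathbb{F}_2$-span of $\{\phi_{(A,x)} : A \subseteq [n], \#A = i, x \in A\}$ inside the space of multilinear maps $V_{[n]}^i \to \mathbb{F}_2$. -}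

module Defs where

open import Data.Bool using (Bool; true; false; _∧_; _∨_; _xor_; not; if_then_else_)
open import Data.Nat using (ℕ; zero; suc; _+_)
open import Data.Fin using (Fin; zero; suc; toℕ; _≟_)
open import Data.Fin.Subset using (Subset; _∈_; ∣_∣)
open import Data.Vec using (lookup)
open import Data.List using (List; []; _∷_; map; concatMap; allFin; foldr)
open import Data.Product using (Σ; _×_; _,_; ∃)
open import Relation.Binary.PropositionalEquality using (_≡_)
open import Relation.Nullary.Decidable using (⌊_⌋)
open import Data.Nat.Base using () renaming (_≡ᵇ_ to _==_)

-- F₂ is Bool with _xor_ as addition and _∧_ as multiplication.

-- V_[n] = F₂^[n], vectors as functions Fin n → Bool (index h ∈ Fin n ↔ h+1 ∈ [n]).
V : ℕ → Set
V n = Fin n → Bool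

χ : ∀ {n} → Fin n → V n → Bool
χ h σ = σ h

-- (not necessarily multilinear) maps V_[n]^i → F₂; Gov lives inside the multilinear ones
Map : ℕ → ℕ → Set
Map n i = (Fin i → V n) → Bool

_≈_ : ∀ {n i} → Map n i → Map n i → Set
f ≈ g = ∀ σ → f σ ≡ g σ

zeroMap : ∀ {n i} → Map n i
zeroMap _ = false

_⊕_ : ∀ {n i} → Map n i → Map n i → Map n i
(f ⊕ g) σ = f σ xor g σ

allB : ∀ {k} → (Fin k → Bool) → Bool
allB {zero} f = true
allB {suc k} f = f zero ∧ allB (λ j → f (suc j))

anyB : ∀ {k} → (Fin k → Bool) → Bool
anyB {zero} f = false
anyB {suc k} f = f zero ∨ anyB (λ j → f (suc j))

tensor : ∀ {n i} → (Fin i → (V n → Bool)) → Map n i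
tensor ls σ = allB (λ j → ls j (σ j))

sumMaps : ∀ {n i} → List (Map n i) → Map n i
sumMaps = foldr _⊕_ zeroMap

cons : ∀ {i n} → Fin n → (Fin i → Fin n) → (Fin (suc i) → Fin n)
cons a f zero = a
cons a f (suc j) = f j

allFuns : (i n : ℕ) → List (Fin i → Fin n)
allFuns zero n = (λ ()) ∷ []
allFuns (suc i) n = concatMap (λ a → map (cons a) (allFuns i n)) (allFin n)

_=ᶠ_ : ∀ {n} → Fin n → Fin n → Bool
a =ᶠ b = ⌊ a ≟ b ⌋

isBijOnto : ∀ {i n} → Subset n → (Fin i → Fin n) → Bool
isBijOnto {i} {n} A τ =
  allB (λ j → lookup A (τ j))
  ∧ allB (λ j → allB (λ k → (j =ᶠ k) ∨ not (τ j =ᶠ τ k)))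
  ∧ allB (λ a → not (lookup A a) ∨ anyB (λ j → τ j =ᶠ a))

-- position j ∈ Fin i (0-based) is position (i-1) or i of [i] (1-based)
lastTwo : ∀ {i} → Fin i → Bool
lastTwo {i} j = ((toℕ j + 2) == i) ∨ ((toℕ j + 1) == i)

govCond : ∀ {i n} → Subset n → Fin n → (Fin i → Fin n) → Bool
govCond {i} A x τ = isBijOnto A τ ∧ anyB (λ j → lastTwo j ∧ (τ j =ᶠ x))

φ : ∀ {n i} → Subset n → Fin n → Map n i
φ {n} {i} A x = sumMaps (map (λ τ σ → govCond A x τ ∧ tensor (λ j → χ (τ j)) σ) (allFuns i n))

GovIndex : ℕ → ℕ → Set
GovIndex n i = Σ (Subset n × Fin n) λ { (A , x) → ∣ A ∣ ≡ i × x ∈ A }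

govGen : ∀ {n i} → GovIndex n i → Map n i
govGen ((A , x) , _) = φ A x

-- membership in Gov(V_[n], i) = F₂-span of the φ_(A,x)
-- (over F₂ a linear combination is a finite sum of generators)
InGov : (n i : ℕ) → Map n i → Set
InGov n i f = ∃ λ (gs : List (GovIndex n i)) → f ≈ sumMaps (map govGen gs)

lincomb : ∀ {n i d} → (Fin d → Bool) → (Fin d → Map n i) → Map n i
lincomb {d = zero} c b = zeroMap
lincomb {d = suc d} c b σ = (c zero ∧ b zero σ) xor lincomb (λ j → c (suc j)) (λ j → b (suc j)) σ

HasDim : ∀ {n i} → (Map n i → Set) → ℕ → Set
HasDim {n} {i} W d = Σ (Fin d → Map n i) λ b →
    (∀ j → W (b j))
  × (∀ c → lincomb c b ≈ zeroMap → ∀ j → c j ≡ false)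
  × (∀ f → W f → ∃ λ c → f ≈ lincomb c b)

module Submission where

-- Write i = k + 2.  The tensor χ_τ(1) ⊗ … ⊗ χ_τ(i) evaluated at a tuple of
-- unit vectors e_τ'(1),…,e_τ'(i) is 1 exactly when τ = τ'.  Hence
-- φ_(A,x)(e_τ) = 1 iff τ is a bijection onto A putting x at position i-1 or i.
-- Two consequences give the result:
--  * the relation Σ_{x ∈ A} φ_(A,x) = 0, since each bijection τ onto A is
--    counted once for x = τ(i-1) and once for x = τ(i);
--  * duality: if v enumerates A and x = v_p is not the last element v_{i-1},
--    the tuple e_τ with τ = v ∘ (i-1 ↔ p) is seen by φ_(A,x) and by no other
--    φ_(A',x') with x' not last in A'.
-- So the φ_(A,v_p), p < i-1, span Gov (the last one being the sum of the
-- others) and are independent; there are (i-1)·C(n,i) of them.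

open import Defs
open import Data.Nat using (ℕ; zero; suc; _+_; _*_; _∸_; _≤_; s≤s)
open import Data.Nat.Combinatorics using (_C_)

open import Algebra.Bundles using (CommutativeRing; CommutativeMonoid)
open import Data.Bool using (Bool; true; false; _∧_; _∨_; _xor_; not)
open import Data.Bool.Properties
  using (xor-∧-commutativeRing; ∧-commutativeMonoid; xor-identityʳ; xor-assoc;
         ∧-identityʳ; ∧-zeroʳ; ∧-distribˡ-xor; ∨-identityʳ; ∨-zeroʳ)
open import Data.Empty using (⊥-elim)
open import Data.Fin as Fin using (Fin; zero; suc; _≟_; inject₁; fromℕ; punchIn)
open import Data.Fin.Permutation.Components using (transpose; transpose-inverse)
open import Data.Fin.Properties using (fromℕ≢inject₁; inject₁-injective; punchInᵢ≢i; 0≢1+n)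
import Data.Fin.Properties as FinP
open import Data.Fin.Subset using (Subset; _∈_; _⊆_; ∣_∣) renaming (⊥ to ∅)
open import Data.Fin.Subset.Properties using (⊆-antisym; ∉⊥; ∣⊥∣≡0)
open import Data.List as List using (List; []; _∷_; map; concatMap; allFin; foldr; _++_; length; cartesianProduct; tabulate)
open import Data.List.Properties using (length-++; length-map; length-tabulate)
open import Data.List.Membership.Propositional using () renaming (_∈_ to _∈ᴸ_)
open import Data.List.Membership.Propositional.Properties
  using (∈-++⁻; ∈-map⁻; ∈-map⁺; ∈-++⁺ˡ; ∈-++⁺ʳ; ∈-lookup; ∈-cartesianProduct⁺; ∈-cartesianProduct⁻; ∈-allFin)
open import Data.List.Relation.Unary.Any using (here; index)
open import Data.List.Relation.Unary.Any.Properties using (lookup-index)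
import Data.List.Relation.Unary.All as All
open import Data.List.Relation.Unary.AllPairs using ([]; _∷_)
open import Data.List.Relation.Unary.Unique.Propositional using (Unique)
import Data.List.Relation.Unary.Unique.Propositional.Properties as Unique
open import Data.Nat.Combinatorics using (nCk+nC[k+1]≡[n+1]C[k+1])
open import Data.Nat.Properties using (*-comm; suc-injective)
open import Data.Product using (_×_; _,_; ∃; proj₁; proj₂)
open import Data.Product.Properties using (,-injective)
open import Data.Sum using (_⊎_; inj₁; inj₂)
open import Data.Vec as Vec using (Vec; []; _∷_; lookup)
open import Data.Vec.Properties using ([]=⇒lookup; lookup⇒[]=; lookup-map; ∷-injective)
open import Function using (_∘_)
open import Relation.Binary.PropositionalEquality
open import Relation.Nullary using (¬_; yes; no)
open import Relation.Nullary.Decidable using (isYes≗does; dec-true; dec-false)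

module F₂ = CommutativeRing xor-∧-commutativeRing
open import Algebra.Properties.Semiring.Sum F₂.semiring
  using (sum; sum-cong-≗; sum-remove; ∑-distrib-+; *-distribʳ-sum; sum-init-last)
open import Algebra.Properties.CommutativeSemigroup
  (CommutativeMonoid.commutativeSemigroup ∧-commutativeMonoid) using (x∙yz≈y∙xz)

open ≡-Reasoning

=ᶠ-sound : ∀ {n} {a b : Fin n} → (a =ᶠ b) ≡ true → a ≡ b
=ᶠ-sound {a = a} {b} e with a ≟ b
... | yes a≡b = a≡b

=ᶠ-complete : ∀ {n} {a b : Fin n} → a ≡ b → (a =ᶠ b) ≡ true
=ᶠ-complete {a = a} {b} a≡b = trans (isYes≗does (a ≟ b)) (dec-true (a ≟ b) a≡b)

=ᶠ-false : ∀ {n} {a b : Fin n} → a ≢ b → (a =ᶠ b) ≡ false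
=ᶠ-false {a = a} {b} a≢b = trans (isYes≗does (a ≟ b)) (dec-false (a ≟ b) a≢b)

∧-elim : ∀ {a b} → a ∧ b ≡ true → a ≡ true × b ≡ true
∧-elim {true} {true} _ = refl , refl

∧-intro : ∀ {a b} → a ≡ true → b ≡ true → a ∧ b ≡ true
∧-intro refl refl = refl

∨-elim : ∀ {a b} → a ∨ b ≡ true → a ≡ true ⊎ b ≡ true
∨-elim {true} _ = inj₁ refl
∨-elim {false} e = inj₂ e

disjoint-∨ : ∀ a b → (a ≡ true → b ≡ false) → a ∨ b ≡ a xor b
disjoint-∨ false b _ = refl
disjoint-∨ true false _ = refl
disjoint-∨ true true d with d refl
... | ()

allB-elim : ∀ {k} {f : Fin k → Bool} → allB f ≡ true → ∀ j → f j ≡ true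
allB-elim {suc k} e zero = proj₁ (∧-elim e)
allB-elim {suc k} {f} e (suc j) = allB-elim (proj₂ (∧-elim {f zero} e)) j

allB-intro : ∀ {k} {f : Fin k → Bool} → (∀ j → f j ≡ true) → allB f ≡ true
allB-intro {zero} h = refl
allB-intro {suc k} h = ∧-intro (h zero) (allB-intro (h ∘ suc))

anyB-elim : ∀ {k} {f : Fin k → Bool} → anyB f ≡ true → ∃ λ j → f j ≡ true
anyB-elim {suc k} {f} e with ∨-elim {f zero} e
... | inj₁ e₀ = zero , e₀
... | inj₂ e₁ with anyB-elim e₁
...   | j , eⱼ = suc j , eⱼ

anyB-intro : ∀ {k} {f : Fin k → Bool} j → f j ≡ true → anyB f ≡ true
anyB-intro zero e rewrite e = refl
anyB-intro {f = f} (suc j) e rewrite anyB-intro {f = f ∘ suc} j e = ∨-zeroʳ (f zero)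

allB-cong : ∀ {k} {f g : Fin k → Bool} → (∀ j → f j ≡ g j) → allB f ≡ allB g
allB-cong {zero} h = refl
allB-cong {suc k} h = cong₂ _∧_ (h zero) (allB-cong (h ∘ suc))

anyB-cong : ∀ {k} {f g : Fin k → Bool} → (∀ j → f j ≡ g j) → anyB f ≡ anyB g
anyB-cong {zero} h = refl
anyB-cong {suc k} h = cong₂ _∨_ (h zero) (anyB-cong (h ∘ suc))

sum-zero : ∀ {m} (t : Fin m → Bool) → (∀ j → t j ≡ false) → sum t ≡ false
sum-zero {zero} t h = refl
sum-zero {suc m} t h rewrite h zero = sum-zero (t ∘ suc) (h ∘ suc)

sum-select : ∀ {m} (t : Fin m → Bool) (j₀ : Fin m) → (∀ j → j ≢ j₀ → t j ≡ false) → sum t ≡ t j₀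
sum-select {suc m} t j₀ off = begin
  sum t                                 ≡⟨ sum-remove {i = j₀} t ⟩
  t j₀ xor sum (λ j → t (punchIn j₀ j)) ≡⟨ cong (t j₀ xor_) (sum-zero _ (λ j → off _ (punchInᵢ≢i j₀ j))) ⟩
  t j₀ xor false                        ≡⟨ xor-identityʳ (t j₀) ⟩
  t j₀                                  ∎

sum-pick : ∀ {m} (a₀ : Fin m) (t : Fin m → Bool) → sum (λ a → (a₀ =ᶠ a) ∧ t a) ≡ t a₀
sum-pick a₀ t = trans (sum-select _ a₀ off) (cong (_∧ t a₀) (=ᶠ-complete refl))
  where
  off : ∀ a → a ≢ a₀ → ((a₀ =ᶠ a) ∧ t a) ≡ false
  off a a≢a₀ = cong (_∧ t a) (=ᶠ-false (a≢a₀ ∘ sym))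

lincomb-sum : ∀ {n i d} (c : Fin d → Bool) (b : Fin d → Map n i) σ →
  lincomb c b σ ≡ sum (λ j → c j ∧ b j σ)
lincomb-sum {d = zero} c b σ = refl
lincomb-sum {d = suc d} c b σ = cong ((c zero ∧ b zero σ) xor_) (lincomb-sum (c ∘ suc) (b ∘ suc) σ)

listSum : ∀ {A : Set} → (A → Bool) → List A → Bool
listSum h = foldr (λ a s → h a xor s) false

sumMaps-listSum : ∀ {A : Set} {n i} (F : A → Map n i) (xs : List A) σ →
  sumMaps (map F xs) σ ≡ listSum (λ a → F a σ) xs
sumMaps-listSum F [] σ = refl
sumMaps-listSum F (x ∷ xs) σ = cong (F x σ xor_) (sumMaps-listSum F xs σ)

listSum-cong : ∀ {A : Set} {f g : A → Bool} (xs : List A) → (∀ a → f a ≡ g a) → listSum f xs ≡ listSum g xs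
listSum-cong [] h = refl
listSum-cong (x ∷ xs) h = cong₂ _xor_ (h x) (listSum-cong xs h)

listSum-zero : ∀ {A : Set} {f : A → Bool} (xs : List A) → (∀ a → f a ≡ false) → listSum f xs ≡ false
listSum-zero [] h = refl
listSum-zero (x ∷ xs) h rewrite h x = listSum-zero xs h

listSum-++ : ∀ {A : Set} (h : A → Bool) xs ys → listSum h (xs ++ ys) ≡ listSum h xs xor listSum h ys
listSum-++ h [] ys = refl
listSum-++ h (x ∷ xs) ys rewrite listSum-++ h xs ys = sym (xor-assoc (h x) _ _)

listSum-map : ∀ {A B : Set} (h : B → Bool) (f : A → B) xs → listSum h (map f xs) ≡ listSum (h ∘ f) xs
listSum-map h f [] = refl
listSum-map h f (x ∷ xs) = cong (h (f x) xor_) (listSum-map h f xs)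

listSum-concatMap : ∀ {A B : Set} (h : B → Bool) (G : A → List B) xs →
  listSum h (concatMap G xs) ≡ listSum (listSum h ∘ G) xs
listSum-concatMap h G [] = refl
listSum-concatMap h G (x ∷ xs) =
  trans (listSum-++ h (G x) (concatMap G xs)) (cong (listSum h (G x) xor_) (listSum-concatMap h G xs))

listSum-∧ˡ : ∀ {A : Set} t (f : A → Bool) xs → listSum (λ a → t ∧ f a) xs ≡ t ∧ listSum f xs
listSum-∧ˡ t f [] = sym (∧-zeroʳ t)
listSum-∧ˡ t f (x ∷ xs) rewrite listSum-∧ˡ t f xs = sym (∧-distribˡ-xor t (f x) _)

listSum-tabulate : ∀ {A : Set} {m} (h : A → Bool) (f : Fin m → A) → listSum h (tabulate f) ≡ sum (h ∘ f)
listSum-tabulate {m = zero} h f = refl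
listSum-tabulate {m = suc m} h f = cong (h (f zero) xor_) (listSum-tabulate h (f ∘ suc))

listSum-allFin : ∀ {m} (h : Fin m → Bool) → listSum h (allFin m) ≡ sum h
listSum-allFin h = listSum-tabulate h (λ j → j)

sum-listSum-comm : ∀ {A : Set} {m} (g : Fin m → A → Bool) (xs : List A) →
  sum (λ q → listSum (g q) xs) ≡ listSum (λ a → sum (λ q → g q a)) xs
sum-listSum-comm {m = m} g [] = sum-zero {m} _ (λ _ → refl)
sum-listSum-comm g (x ∷ xs) =
  trans (∑-distrib-+ (λ q → g q x) (λ q → listSum (g q) xs)) (cong (sum (λ q → g q x) xor_) (sum-listSum-comm g xs))

-- The last two positions i-1 and i of [i], i = k + 2 (0-based: k and k+1).
penult : ∀ k → Fin (suc (suc k))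
penult k = inject₁ (fromℕ k)

final : ∀ k → Fin (suc (suc k))
final k = fromℕ (suc k)

penult≢final : ∀ k → penult k ≢ final k
penult≢final k e = fromℕ≢inject₁ (sym e)

anyB-lastTwo : ∀ k (P : Fin (suc (suc k)) → Bool) → anyB (λ j → lastTwo j ∧ P j) ≡ P (penult k) ∨ P (final k)
anyB-lastTwo zero P = cong (P zero ∨_) (∨-identityʳ (P (suc zero)))
anyB-lastTwo (suc k) P = anyB-lastTwo k (P ∘ suc)

inject₁-or-last : ∀ {m} (q : Fin (suc m)) → (∃ λ p → q ≡ inject₁ p) ⊎ q ≡ fromℕ m
inject₁-or-last {zero} zero = inj₂ refl
inject₁-or-last {suc m} zero = inj₁ (zero , refl)
inject₁-or-last {suc m} (suc q) with inject₁-or-last q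
... | inj₁ (p , e) = inj₁ (suc p , cong suc e)
... | inj₂ e = inj₂ (cong suc e)

InSpan : ∀ {n i d} → (Fin d → Map n i) → Map n i → Set
InSpan b f = ∃ λ c → f ≈ lincomb c b

module _ {n i d} {b : Fin d → Map n i} where

  inSpan-resp : ∀ {f g} → InSpan b g → f ≈ g → InSpan b f
  inSpan-resp (c , g≈) f≈g = c , λ σ → trans (f≈g σ) (g≈ σ)

  inSpan-zero : InSpan b zeroMap
  inSpan-zero = (λ _ → false) , λ σ → sym (trans (lincomb-sum _ b σ) (sum-zero {d} _ (λ _ → refl)))

  inSpan-⊕ : ∀ {f g} → InSpan b f → InSpan b g → InSpan b (f ⊕ g)
  inSpan-⊕ {f} {g} (c , f≈) (c' , g≈) = (λ j → c j xor c' j) , λ σ → begin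
    f σ xor g σ                                              ≡⟨ cong₂ _xor_ (trans (f≈ σ) (lincomb-sum c b σ)) (trans (g≈ σ) (lincomb-sum c' b σ)) ⟩
    sum (λ j → c j ∧ b j σ) xor sum (λ j → c' j ∧ b j σ)    ≡⟨ sym (∑-distrib-+ (λ j → c j ∧ b j σ) (λ j → c' j ∧ b j σ)) ⟩
    sum (λ j → (c j ∧ b j σ) xor (c' j ∧ b j σ))            ≡⟨ sum-cong-≗ (λ j → sym (F₂.distribʳ (b j σ) (c j) (c' j))) ⟩
    sum (λ j → (c j xor c' j) ∧ b j σ)                       ≡⟨ sym (lincomb-sum _ b σ) ⟩
    lincomb (λ j → c j xor c' j) b σ                         ∎

  inSpan-member : ∀ j → InSpan b (b j)
  inSpan-member j = (j =ᶠ_) , λ σ → sym (trans (lincomb-sum _ b σ) (sum-pick j (λ j' → b j' σ)))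

  inSpan-sum : ∀ {m} (h : Fin m → Map n i) → (∀ p → InSpan b (h p)) → InSpan b (λ σ → sum (λ p → h p σ))
  inSpan-sum {zero} h s = inSpan-zero
  inSpan-sum {suc m} h s = inSpan-⊕ (s zero) (inSpan-sum (h ∘ suc) (s ∘ suc))

  inSpan-sumMaps : ∀ {A : Set} (g : A → Map n i) → (∀ a → InSpan b (g a)) → ∀ xs → InSpan b (sumMaps (map g xs))
  inSpan-sumMaps g s [] = inSpan-zero
  inSpan-sumMaps g s (x ∷ xs) = inSpan-⊕ (s x) (inSpan-sumMaps g s xs)

  -- Dual points: if b j is 1 at pt j and b j' vanishes at pt j for j' ≠ j,
  -- evaluating a vanishing combination at pt j isolates its coefficient c j.
  independent-by-duality : (pt : Fin d → (Fin i → V n)) →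
    (∀ j → b j (pt j) ≡ true) → (∀ j j' → b j' (pt j) ≡ true → j' ≡ j) →
    ∀ c → lincomb c b ≈ zeroMap → ∀ j → c j ≡ false
  independent-by-duality pt diag dual c c≈0 j = begin
    c j                              ≡⟨ sym (∧-identityʳ (c j)) ⟩
    c j ∧ true                       ≡⟨ cong (c j ∧_) (sym (diag j)) ⟩
    c j ∧ b j (pt j)                 ≡⟨ sym (sum-select _ j off) ⟩
    sum (λ j' → c j' ∧ b j' (pt j))  ≡⟨ sym (lincomb-sum c b (pt j)) ⟩
    lincomb c b (pt j)               ≡⟨ c≈0 (pt j) ⟩
    false                            ∎
    where
    off : ∀ j' → j' ≢ j → c j' ∧ b j' (pt j) ≡ false
    off j' j'≢j with b j' (pt j) in e
    ... | false = ∧-zeroʳ (c j')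
    ... | true = ⊥-elim (j'≢j (dual j j' e))

hasDim-by-duality : ∀ {n i d} (W : Map n i → Set) (b : Fin d → Map n i) (pt : Fin d → (Fin i → V n)) →
  (∀ j → W (b j)) → (∀ j → b j (pt j) ≡ true) → (∀ j j' → b j' (pt j) ≡ true → j' ≡ j) →
  (∀ f → W f → InSpan b f) → HasDim W d
hasDim-by-duality W b pt inW diag dual spans = b , inW , independent-by-duality pt diag dual , spans

unitTuple : ∀ {n i} → (Fin i → Fin n) → (Fin i → V n)
unitTuple τ j h = τ j =ᶠ h

-- Boolean functions of tuples τ : [i] → [n] that respect pointwise equality
-- (the enumeration allFuns produces tuples only up to pointwise equality).
Extensional : ∀ {i n} → ((Fin i → Fin n) → Bool) → Set
Extensional {i} {n} g = ∀ {τ τ' : Fin i → Fin n} → (∀ j → τ j ≡ τ' j) → g τ ≡ g τ'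

-- χ_τ'(1) ⊗ … ⊗ χ_τ'(i) takes the value [τ = τ'] at e_τ, so a combination
-- Σ_τ' g τ' · χ_τ' evaluated at e_τ is g τ.
sum-tensors-at-unit : ∀ i n (g : (Fin i → Fin n) → Bool) → Extensional g → (τ : Fin i → Fin n) →
  listSum (λ τ' → g τ' ∧ tensor (λ j → χ (τ' j)) (unitTuple τ)) (allFuns i n) ≡ g τ
sum-tensors-at-unit zero n g ext τ = trans (xor-identityʳ _) (trans (∧-identityʳ _) (ext (λ ())))
sum-tensors-at-unit (suc i) n g ext τ = begin
  listSum H (concatMap (λ a → map (cons a) (allFuns i n)) (allFin n))
    ≡⟨ listSum-concatMap H _ (allFin n) ⟩
  listSum (λ a → listSum H (map (cons a) (allFuns i n))) (allFin n)
    ≡⟨ listSum-allFin {n} (λ a → listSum H (map (cons a) (allFuns i n))) ⟩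
  sum (λ a → listSum H (map (cons a) (allFuns i n)))
    ≡⟨ sum-cong-≗ first-coordinate ⟩
  sum (λ a → (τ zero =ᶠ a) ∧ g (cons a (τ ∘ suc)))
    ≡⟨ sum-pick (τ zero) (λ a → g (cons a (τ ∘ suc))) ⟩
  g (cons (τ zero) (τ ∘ suc))
    ≡⟨ ext (λ { zero → refl ; (suc j) → refl }) ⟩
  g τ ∎
  where
  H : (Fin (suc i) → Fin n) → Bool
  H τ' = g τ' ∧ tensor (λ j → χ (τ' j)) (unitTuple τ)
  cons-cong : ∀ a {f f' : Fin i → Fin n} → (∀ j → f j ≡ f' j) → ∀ j → cons a f j ≡ cons a f' j
  cons-cong a e zero = refl
  cons-cong a e (suc j) = e j
  -- the tuples with first entry a contribute [τ 0 = a] times the induction hypothesis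
  first-coordinate : ∀ a → listSum H (map (cons a) (allFuns i n)) ≡ (τ zero =ᶠ a) ∧ g (cons a (τ ∘ suc))
  first-coordinate a = begin
    listSum H (map (cons a) (allFuns i n))
      ≡⟨ listSum-map H (cons a) (allFuns i n) ⟩
    listSum (λ f → g (cons a f) ∧ ((τ zero =ᶠ a) ∧ T f)) (allFuns i n)
      ≡⟨ listSum-cong (allFuns i n) (λ f → x∙yz≈y∙xz (g (cons a f)) (τ zero =ᶠ a) (T f)) ⟩
    listSum (λ f → (τ zero =ᶠ a) ∧ (g (cons a f) ∧ T f)) (allFuns i n)
      ≡⟨ listSum-∧ˡ (τ zero =ᶠ a) _ (allFuns i n) ⟩
    (τ zero =ᶠ a) ∧ listSum (λ f → g (cons a f) ∧ T f) (allFuns i n)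
      ≡⟨ cong ((τ zero =ᶠ a) ∧_) (sum-tensors-at-unit i n (g ∘ cons a) (ext ∘ cons-cong a) (τ ∘ suc)) ⟩
    (τ zero =ᶠ a) ∧ g (cons a (τ ∘ suc)) ∎
    where
    T : (Fin i → Fin n) → Bool
    T f = tensor (λ j → χ (f j)) (unitTuple (τ ∘ suc))

govCond-extensional : ∀ {i n} (A : Subset n) (x : Fin n) → Extensional {i} {n} (govCond A x)
govCond-extensional A x e =
  cong₂ _∧_
    (cong₂ _∧_ (allB-cong (λ j → cong (lookup A) (e j)))
      (cong₂ _∧_ (allB-cong (λ j → allB-cong (λ k → cong₂ (λ u w → (j =ᶠ k) ∨ not (u =ᶠ w)) (e j) (e k))))
        (allB-cong (λ a → cong (not (lookup A a) ∨_) (anyB-cong (λ j → cong (_=ᶠ a) (e j)))))))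
    (anyB-cong (λ j → cong (λ y → lastTwo j ∧ (y =ᶠ x)) (e j)))

φ-at-unit : ∀ {n i} (A : Subset n) (x : Fin n) (τ : Fin i → Fin n) → φ A x (unitTuple τ) ≡ govCond A x τ
φ-at-unit {n} {i} A x τ =
  trans (sumMaps-listSum (λ τ' σ → govCond A x τ' ∧ tensor (λ j → χ (τ' j)) σ) (allFuns i n) (unitTuple τ))
        (sum-tensors-at-unit i n (govCond A x) (govCond-extensional A x) τ)

record BijectionOnto {i n} (A : Subset n) (τ : Fin i → Fin n) : Set where
  field
    into      : ∀ j → τ j ∈ A
    injective : ∀ j j' → τ j ≡ τ j' → j ≡ j'
    onto      : ∀ {y} → y ∈ A → ∃ λ j → τ j ≡ y
open BijectionOnto

isBijOnto-sound : ∀ {i n} (A : Subset n) (τ : Fin i → Fin n) → isBijOnto A τ ≡ true → BijectionOnto A τ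
isBijOnto-sound A τ e with ∧-elim e
... | members , rest with ∧-elim rest
...   | distinct , covering = record
  { into      = λ j → lookup⇒[]= (τ j) A (allB-elim members j)
  ; injective = λ j j' τj≡τj' → =ᶠ-sound (∨-not-true (allB-elim (allB-elim distinct j) j') (=ᶠ-complete τj≡τj'))
  ; onto      = λ {y} y∈A → let (j , τj≡y) = anyB-elim (not-∨-true (allB-elim covering y) ([]=⇒lookup y∈A))
                             in j , =ᶠ-sound τj≡y }
  where
  ∨-not-true : ∀ {a b} → a ∨ not b ≡ true → b ≡ true → a ≡ true
  ∨-not-true {true} _ _ = refl
  ∨-not-true {false} {true} () _
  ∨-not-true {false} {false} _ ()
  not-∨-true : ∀ {a b} → not a ∨ b ≡ true → a ≡ true → b ≡ true
  not-∨-true {true} e _ = e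
  not-∨-true {false} _ ()

isBijOnto-complete : ∀ {i n} (A : Subset n) (τ : Fin i → Fin n) → BijectionOnto A τ → isBijOnto A τ ≡ true
isBijOnto-complete A τ bij =
  ∧-intro (allB-intro (λ j → []=⇒lookup (into bij j)))
    (∧-intro (allB-intro (λ j → allB-intro (distinct j))) (allB-intro covering))
  where
  distinct : ∀ j j' → ((j =ᶠ j') ∨ not (τ j =ᶠ τ j')) ≡ true
  distinct j j' with j ≟ j'
  ... | yes _ = refl
  ... | no j≢j' = cong not (=ᶠ-false (j≢j' ∘ injective bij j j'))
  covering : ∀ y → (not (lookup A y) ∨ anyB (λ j → τ j =ᶠ y)) ≡ true
  covering y with lookup A y in e
  ... | false = refl
  ... | true = let (j , τj≡y) = onto bij (lookup⇒[]= y A e) in anyB-intro j (=ᶠ-complete τj≡y)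

bijection-image-unique : ∀ {i n} {A B : Subset n} {τ : Fin i → Fin n} →
  BijectionOnto A τ → BijectionOnto B τ → A ≡ B
bijection-image-unique {A = A} {B} {τ} bijA bijB = ⊆-antisym (image⊆ bijA bijB) (image⊆ bijB bijA)
  where
  image⊆ : ∀ {P Q} → BijectionOnto P τ → BijectionOnto Q τ → P ⊆ Q
  image⊆ {Q = Q} bijP bijQ y∈P = let (j , τj≡y) = onto bijP y∈P in subst (_∈ Q) τj≡y (into bijQ j)

bijection-∘-transpose : ∀ {i n} {A : Subset n} {τ : Fin i → Fin n} (a b : Fin i) →
  BijectionOnto A τ → BijectionOnto A (τ ∘ transpose a b)
bijection-∘-transpose {τ = τ} a b bij = record
  { into      = into bij ∘ transpose a b
  ; injective = λ j j' e → trans (sym (transpose-inverse b a))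
                             (trans (cong (transpose b a) (injective bij _ _ e)) (transpose-inverse b a))
  ; onto      = λ y∈A → let (j , τj≡y) = onto bij y∈A
                        in transpose b a j , trans (cong τ (transpose-inverse a b)) τj≡y }

govCond-lastTwo : ∀ {n} k (A : Subset n) (x : Fin n) (τ : Fin (suc (suc k)) → Fin n) →
  govCond A x τ ≡ isBijOnto A τ ∧ ((τ (penult k) =ᶠ x) ∨ (τ (final k) =ᶠ x))
govCond-lastTwo k A x τ = cong (isBijOnto A τ ∧_) (anyB-lastTwo k (λ j → τ j =ᶠ x))

-- A bijection τ onto A contributes its tensor χ_τ once
-- for x = τ(i-1) and once for x = τ(i); these differ, so the total is 0.
governing-relation : ∀ {n} k {A : Subset n} {ν : Fin (suc (suc k)) → Fin n} → BijectionOnto A ν →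
  ∀ σ → sum (λ q → φ A (ν q) σ) ≡ false
governing-relation {n} k {A} {ν} enum σ = begin
  sum (λ q → φ A (ν q) σ)
    ≡⟨ sum-cong-≗ (λ q → sumMaps-listSum (λ τ σ → govCond A (ν q) τ ∧ tensor (λ j → χ (τ j)) σ) (allFuns I n) σ) ⟩
  sum (λ q → listSum (λ τ → govCond A (ν q) τ ∧ T τ) (allFuns I n))
    ≡⟨ sum-listSum-comm (λ q τ → govCond A (ν q) τ ∧ T τ) (allFuns I n) ⟩
  listSum (λ τ → sum (λ q → govCond A (ν q) τ ∧ T τ)) (allFuns I n)
    ≡⟨ listSum-zero (allFuns I n) (λ τ → trans (sym (*-distribʳ-sum (T τ) (λ q → govCond A (ν q) τ)))
                                              (cong (_∧ T τ) (counted-twice τ))) ⟩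
  false ∎
  where
  I = suc (suc k)
  T : (Fin I → Fin n) → Bool
  T τ = tensor (λ j → χ (τ j)) σ
  hit-once : ∀ {τ : Fin I → Fin n} → BijectionOnto A τ → ∀ j → sum (λ q → τ j =ᶠ ν q) ≡ true
  hit-once {τ} bij j with onto enum (into bij j)
  ... | q₀ , νq₀≡τj = trans (sum-select _ q₀ off) (=ᶠ-complete (sym νq₀≡τj))
    where
    off : ∀ q → q ≢ q₀ → (τ j =ᶠ ν q) ≡ false
    off q q≢q₀ = =ᶠ-false (λ τj≡νq → q≢q₀ (injective enum q q₀ (trans (sym τj≡νq) (sym νq₀≡τj))))
  counted-twice-bij : ∀ {τ : Fin I → Fin n} → BijectionOnto A τ →
    sum (λ q → (τ (penult k) =ᶠ ν q) ∨ (τ (final k) =ᶠ ν q)) ≡ false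
  counted-twice-bij {τ} bij = begin
    sum (λ q → (τ (penult k) =ᶠ ν q) ∨ (τ (final k) =ᶠ ν q))
      ≡⟨ sum-cong-≗ (λ q → disjoint-∨ (τ (penult k) =ᶠ ν q) (τ (final k) =ᶠ ν q) (λ e → =ᶠ-false (λ e' → distinct-ends (trans (=ᶠ-sound e) (sym e'))))) ⟩
    sum (λ q → (τ (penult k) =ᶠ ν q) xor (τ (final k) =ᶠ ν q))
      ≡⟨ ∑-distrib-+ (λ q → τ (penult k) =ᶠ ν q) (λ q → τ (final k) =ᶠ ν q) ⟩
    sum (λ q → τ (penult k) =ᶠ ν q) xor sum (λ q → τ (final k) =ᶠ ν q)
      ≡⟨ cong₂ _xor_ (hit-once bij (penult k)) (hit-once bij (final k)) ⟩
    true xor true ∎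
    where
    distinct-ends : τ (penult k) ≢ τ (final k)
    distinct-ends e = penult≢final k (injective bij _ _ e)
  counted-twice : ∀ τ → sum (λ q → govCond A (ν q) τ) ≡ false
  counted-twice τ = trans (sum-cong-≗ (λ q → govCond-lastTwo k A (ν q) τ)) (by-bijectivity refl)
    where
    by-bijectivity : ∀ {β} → isBijOnto A τ ≡ β → sum (λ q → β ∧ ((τ (penult k) =ᶠ ν q) ∨ (τ (final k) =ᶠ ν q))) ≡ false
    by-bijectivity {false} _ = sum-zero {I} _ (λ _ → refl)
    by-bijectivity {true} e = counted-twice-bij (isBijOnto-sound A τ e)

Enumeration : ℕ → ℕ → Set
Enumeration n k = Subset n × Vec (Fin n) k

record Enumerates {n k} (A : Subset n) (v : Vec (Fin n) k) : Set where
  field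
    bijection : BijectionOnto A (lookup v)
    size      : ∣ A ∣ ≡ k
open Enumerates

extendIn : ∀ {n k} → Enumeration n k → Enumeration (suc n) (suc k)
extendIn (A , v) = true ∷ A , zero ∷ Vec.map suc v

extendOut : ∀ {n k} → Enumeration n k → Enumeration (suc n) k
extendOut (A , v) = false ∷ A , Vec.map suc v

enumerations : (n k : ℕ) → List (Enumeration n k)
enumerations n zero = (∅ , []) ∷ []
enumerations zero (suc k) = []
enumerations (suc n) (suc k) = map extendIn (enumerations n k) ++ map extendOut (enumerations n (suc k))

lookup-map-suc : ∀ {n k} (v : Vec (Fin n) k) q → lookup (Vec.map Fin.suc v) q ≡ suc (lookup v q)
lookup-map-suc v q = lookup-map q Fin.suc v

map-suc-injective : ∀ {n k} {v v' : Vec (Fin n) k} → Vec.map Fin.suc v ≡ Vec.map Fin.suc v' → v ≡ v'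
map-suc-injective {v = []} {[]} _ = refl
map-suc-injective {v = x ∷ v} {y ∷ v'} e =
  cong₂ _∷_ (FinP.suc-injective (proj₁ (∷-injective e))) (map-suc-injective (proj₂ (∷-injective e)))

enumerates-∅ : ∀ n → Enumerates (∅ {n}) []
enumerates-∅ n = record
  { bijection = record { into = λ () ; injective = λ () ; onto = λ y∈∅ → ⊥-elim (∉⊥ y∈∅) }
  ; size = ∣⊥∣≡0 n }

enumerates-extendIn : ∀ {n k} {A : Subset n} {v : Vec (Fin n) k} → Enumerates A v →
  Enumerates (true ∷ A) (zero ∷ Vec.map suc v)
enumerates-extendIn {A = A} {v} E = record
  { bijection = record { into = into′ ; injective = injective′ ; onto = onto′ }
  ; size = cong suc (size E) }
  where
  bij = bijection E
  into′ : ∀ q → lookup (zero ∷ Vec.map suc v) q ∈ true ∷ A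
  into′ zero = Vec.here
  into′ (suc q) = subst (_∈ true ∷ A) (sym (lookup-map-suc v q)) (Vec.there (into bij q))
  injective′ : ∀ q q' → lookup (zero ∷ Vec.map suc v) q ≡ lookup (zero ∷ Vec.map suc v) q' → q ≡ q'
  injective′ zero zero _ = refl
  injective′ zero (suc q') e = ⊥-elim (0≢1+n (trans e (lookup-map-suc v q')))
  injective′ (suc q) zero e = ⊥-elim (0≢1+n (trans (sym e) (lookup-map-suc v q)))
  injective′ (suc q) (suc q') e =
    cong suc (injective bij q q' (FinP.suc-injective (trans (sym (lookup-map-suc v q)) (trans e (lookup-map-suc v q')))))
  onto′ : ∀ {y} → y ∈ true ∷ A → ∃ λ q → lookup (zero ∷ Vec.map suc v) q ≡ y
  onto′ Vec.here = zero , refl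
  onto′ (Vec.there y∈A) = let (q , vq≡y) = onto bij y∈A in suc q , trans (lookup-map-suc v q) (cong suc vq≡y)

enumerates-extendOut : ∀ {n k} {A : Subset n} {v : Vec (Fin n) k} → Enumerates A v →
  Enumerates (false ∷ A) (Vec.map suc v)
enumerates-extendOut {A = A} {v} E = record
  { bijection = record { into = into′ ; injective = injective′ ; onto = onto′ }
  ; size = size E }
  where
  bij = bijection E
  into′ : ∀ q → lookup (Vec.map suc v) q ∈ false ∷ A
  into′ q = subst (_∈ false ∷ A) (sym (lookup-map-suc v q)) (Vec.there (into bij q))
  injective′ : ∀ q q' → lookup (Vec.map suc v) q ≡ lookup (Vec.map suc v) q' → q ≡ q'
  injective′ q q' e =
    injective bij q q' (FinP.suc-injective (trans (sym (lookup-map-suc v q)) (trans e (lookup-map-suc v q'))))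
  onto′ : ∀ {y} → y ∈ false ∷ A → ∃ λ q → lookup (Vec.map suc v) q ≡ y
  onto′ (Vec.there y∈A) = let (q , vq≡y) = onto bij y∈A in q , trans (lookup-map-suc v q) (cong suc vq≡y)

enumerations-sound : ∀ n k {A v} → (A , v) ∈ᴸ enumerations n k → Enumerates A v
enumerations-sound n zero (here refl) = enumerates-∅ n
enumerations-sound (suc n) (suc k) m with ∈-++⁻ (map extendIn (enumerations n k)) m
... | inj₁ m₁ with ∈-map⁻ extendIn m₁
...   | _ , m' , refl = enumerates-extendIn (enumerations-sound n k m')
enumerations-sound (suc n) (suc k) m | inj₂ m₂ with ∈-map⁻ extendOut m₂
...   | _ , m' , refl = enumerates-extendOut (enumerations-sound n (suc k) m')

enumerations-functional : ∀ n k {A v v'} → (A , v) ∈ᴸ enumerations n k → (A , v') ∈ᴸ enumerations n k → v ≡ v'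
enumerations-functional n zero {v = []} {[]} _ _ = refl
enumerations-functional (suc n) (suc k) m m'
  with ∈-++⁻ (map extendIn (enumerations n k)) m | ∈-++⁻ (map extendIn (enumerations n k)) m'
... | inj₁ m₁ | inj₁ m₁' with ∈-map⁻ extendIn m₁ | ∈-map⁻ extendIn m₁'
...   | _ , p , refl | _ , p' , refl = cong (λ w → zero ∷ Vec.map Fin.suc w) (enumerations-functional n k p p')
enumerations-functional (suc n) (suc k) m m' | inj₁ m₁ | inj₂ m₂' with ∈-map⁻ extendIn m₁ | ∈-map⁻ extendOut m₂'
...   | _ , _ , refl | _ , _ , ()
enumerations-functional (suc n) (suc k) m m' | inj₂ m₂ | inj₁ m₁' with ∈-map⁻ extendOut m₂ | ∈-map⁻ extendIn m₁'
...   | _ , _ , refl | _ , _ , ()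
enumerations-functional (suc n) (suc k) m m' | inj₂ m₂ | inj₂ m₂' with ∈-map⁻ extendOut m₂ | ∈-map⁻ extendOut m₂'
...   | _ , p , refl | _ , p' , refl = cong (Vec.map Fin.suc) (enumerations-functional n (suc k) p p')

size-zero-empty : ∀ {m} (P : Subset m) → ∣ P ∣ ≡ 0 → P ≡ ∅
size-zero-empty [] _ = refl
size-zero-empty (false ∷ P) e = cong (false ∷_) (size-zero-empty P e)

enumerations-complete : ∀ n k (A : Subset n) → ∣ A ∣ ≡ k → ∃ λ v → (A , v) ∈ᴸ enumerations n k
enumerations-complete n zero A ∣A∣≡0 rewrite size-zero-empty A ∣A∣≡0 = [] , here refl
enumerations-complete (suc n) (suc k) (true ∷ A) e with enumerations-complete n k A (suc-injective e)
... | v , m = zero ∷ Vec.map Fin.suc v , ∈-++⁺ˡ (∈-map⁺ extendIn m)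
enumerations-complete (suc n) (suc k) (false ∷ A) e with enumerations-complete n (suc k) A e
... | v , m = Vec.map Fin.suc v , ∈-++⁺ʳ (map extendIn (enumerations n k)) (∈-map⁺ extendOut m)

length-enumerations : ∀ n k → length (enumerations n k) ≡ n C k
length-enumerations n zero = refl
length-enumerations zero (suc k) = refl
length-enumerations (suc n) (suc k) = begin
  length (map extendIn (enumerations n k) ++ map extendOut (enumerations n (suc k)))
    ≡⟨ length-++ (map extendIn (enumerations n k)) ⟩
  length (map extendIn (enumerations n k)) + length (map extendOut (enumerations n (suc k)))
    ≡⟨ cong₂ _+_ (length-map extendIn (enumerations n k)) (length-map extendOut (enumerations n (suc k))) ⟩
  length (enumerations n k) + length (enumerations n (suc k))
    ≡⟨ cong₂ _+_ (length-enumerations n k) (length-enumerations n (suc k)) ⟩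
  n C k + n C suc k
    ≡⟨ nCk+nC[k+1]≡[n+1]C[k+1] n k ⟩
  suc n C suc k ∎

enumerations-unique : ∀ n k → Unique (enumerations n k)
enumerations-unique n zero = All.[] ∷ []
enumerations-unique zero (suc k) = []
enumerations-unique (suc n) (suc k) =
  Unique.++⁺ (Unique.map⁺ extendIn-injective (enumerations-unique n k))
             (Unique.map⁺ extendOut-injective (enumerations-unique n (suc k)))
             disjoint
  where
  extendIn-injective : ∀ {x y : Enumeration n k} → extendIn x ≡ extendIn y → x ≡ y
  extendIn-injective {A , v} {A' , v'} e with ,-injective e
  ... | eA , ev = cong₂ _,_ (proj₂ (∷-injective eA)) (map-suc-injective (proj₂ (∷-injective ev)))
  extendOut-injective : ∀ {x y : Enumeration n (suc k)} → extendOut x ≡ extendOut y → x ≡ y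
  extendOut-injective {A , v} {A' , v'} e with ,-injective e
  ... | eA , ev = cong₂ _,_ (proj₂ (∷-injective eA)) (map-suc-injective ev)
  disjoint : ∀ {c} → ¬ (c ∈ᴸ map extendIn (enumerations n k) × c ∈ᴸ map extendOut (enumerations n (suc k)))
  disjoint (m₁ , m₂) with ∈-map⁻ extendIn m₁ | ∈-map⁻ extendOut m₂
  ... | _ , _ , refl | _ , _ , ()

unique-lookup-injective : ∀ {A : Set} {xs : List A} → Unique xs →
  ∀ j j' → List.lookup xs j ≡ List.lookup xs j' → j ≡ j'
unique-lookup-injective (_ ∷ _) zero zero _ = refl
unique-lookup-injective (x∉xs ∷ _) zero (suc j') e = ⊥-elim (All.lookup x∉xs (∈-lookup j') e)
unique-lookup-injective (x∉xs ∷ _) (suc j) zero e = ⊥-elim (All.lookup x∉xs (∈-lookup j) (sym e))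
unique-lookup-injective (_ ∷ u) (suc j) (suc j') e = cong suc (unique-lookup-injective u j j' e)

length-cartesianProduct : ∀ {A B : Set} (xs : List A) (ys : List B) →
  length (cartesianProduct xs ys) ≡ length xs * length ys
length-cartesianProduct [] ys = refl
length-cartesianProduct (x ∷ xs) ys =
  trans (length-++ (map (x ,_) ys)) (cong₂ _+_ (length-map (x ,_) ys) (length-cartesianProduct xs ys))

transpose-first : ∀ {m} (a b : Fin m) → transpose a b a ≡ b
transpose-first a b rewrite dec-true (a ≟ a) refl = refl

transpose-fixes : ∀ {m} {a b c : Fin m} → c ≢ a → c ≢ b → transpose a b c ≡ c
transpose-fixes {a = a} {b} {c} c≢a c≢b rewrite dec-false (c ≟ a) c≢a | dec-false (c ≟ b) c≢b = refl

xor-≡-false : ∀ {a b} → a xor b ≡ false → a ≡ b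
xor-≡-false {false} {false} _ = refl
xor-≡-false {true} {true} _ = refl

module GovBasis (n k : ℕ) where

  I : ℕ
  I = suc (suc k)

  -- ((A , v) , p) stands for x = v_p ∈ A with p < i - 1: x is not the last element of A.
  Index : Set
  Index = Enumeration n I × Fin (suc k)

  indices : List Index
  indices = cartesianProduct (enumerations n I) (allFin (suc k))

  generator : Index → Map n I
  generator ((A , v) , p) = φ A (lookup v (inject₁ p))

  -- τ = v ∘ (i-1 ↔ p) puts x = v_p at position i-1 and leaves v_{i-1} at position i.
  witness : Index → Fin I → Fin n
  witness ((A , v) , p) = lookup v ∘ transpose (penult k) (inject₁ p)

  listed : ∀ {A v p} → ((A , v) , p) ∈ᴸ indices → Enumerates A v
  listed m = enumerations-sound n I (proj₁ (∈-cartesianProduct⁻ (enumerations n I) (allFin (suc k)) m))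

  witness-penult : ∀ A v p → witness ((A , v) , p) (penult k) ≡ lookup v (inject₁ p)
  witness-penult A v p = cong (lookup v) (transpose-first (penult k) (inject₁ p))

  witness-final : ∀ A v p → witness ((A , v) , p) (final k) ≡ lookup v (final k)
  witness-final A v p = cong (lookup v) (transpose-fixes (penult≢final k ∘ sym) fromℕ≢inject₁)

  witness-bijection : ∀ {A v} p → Enumerates A v → BijectionOnto A (witness ((A , v) , p))
  witness-bijection p E = bijection-∘-transpose (penult k) (inject₁ p) (bijection E)

  generator-diag : ∀ {u} → u ∈ᴸ indices → generator u (unitTuple (witness u)) ≡ true
  generator-diag {(A , v) , p} m = begin
    φ A x (unitTuple τ)                                          ≡⟨ φ-at-unit A x τ ⟩
    govCond A x τ                                                ≡⟨ govCond-lastTwo k A x τ ⟩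
    isBijOnto A τ ∧ ((τ (penult k) =ᶠ x) ∨ (τ (final k) =ᶠ x))  ≡⟨ cong₂ (λ β γ → β ∧ (γ ∨ (τ (final k) =ᶠ x)))
                                                                       (isBijOnto-complete A τ (witness-bijection p (listed m)))
                                                                       (=ᶠ-complete (witness-penult A v p)) ⟩
    true                                                         ∎
    where
    x = lookup v (inject₁ p)
    τ = witness ((A , v) , p)

  -- ... and vanishes at the witness of every other index: the witness determines
  -- A, hence v, and x must sit at position i-1 since position i holds v_{i-1}.
  generator-dual : ∀ {u w} → u ∈ᴸ indices → w ∈ᴸ indices → generator u (unitTuple (witness w)) ≡ true → u ≡ w
  generator-dual {(A , v) , p} {(A' , v') , p'} mu mw e =
    same-index (bijection-image-unique (isBijOnto-sound A τ (proj₁ cond)) (witness-bijection p' Ew)) (proj₂ cond)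
    where
    x = lookup v (inject₁ p)
    τ = witness ((A' , v') , p')
    Ew = listed mw
    cond = ∧-elim (trans (sym (govCond-lastTwo k A x τ)) (trans (sym (φ-at-unit A x τ)) e))
    same-index : A ≡ A' → ((τ (penult k) =ᶠ x) ∨ (τ (final k) =ᶠ x)) ≡ true → ((A , v) , p) ≡ ((A' , v') , p')
    same-index refl position
      with enumerations-functional n I (proj₁ (∈-cartesianProduct⁻ _ _ mu)) (proj₁ (∈-cartesianProduct⁻ _ _ mw))
    ... | refl with ∨-elim position
    ...   | inj₁ at-penult = cong ((A , v) ,_) (sym (inject₁-injective
              (injective (bijection Ew) _ _ (trans (sym (witness-penult A v p')) (=ᶠ-sound at-penult)))))
    ...   | inj₂ at-final = ⊥-elim (fromℕ≢inject₁
              (injective (bijection Ew) _ _ (trans (sym (witness-final A v p')) (=ᶠ-sound at-final))))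

  generator-inGov : ∀ {u} → u ∈ᴸ indices → InGov n I (generator u)
  generator-inGov {(A , v) , p} m =
    ((A , lookup v (inject₁ p)) , size (listed m) , into (bijection (listed m)) (inject₁ p)) ∷ [] ,
    λ σ → sym (xor-identityʳ _)

  basis : Fin (length indices) → Map n I
  basis j = generator (List.lookup indices j)

  basisPoint : Fin (length indices) → (Fin I → V n)
  basisPoint j = unitTuple (witness (List.lookup indices j))

  generator-inSpan : ∀ {u} → u ∈ᴸ indices → InSpan basis (generator u)
  generator-inSpan m = inSpan-resp (inSpan-member (index m)) (λ σ → cong (λ u → generator u σ) (lookup-index m))

  -- Every φ_(A,x) lies in the span: directly if x is not last in A, and by
  -- the governing relation (as the sum of the others) if it is.
  φ-inSpan : ∀ (g : GovIndex n I) → InSpan basis (govGen g)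
  φ-inSpan ((A , x) , ∣A∣≡I , x∈A) with enumerations-complete n I A ∣A∣≡I
  ... | v , mA with onto (bijection (enumerations-sound n I mA)) x∈A
  ...   | q , vq≡x with inject₁-or-last q
  ...     | inj₁ (p , refl) =
    inSpan-resp (generator-inSpan (∈-cartesianProduct⁺ mA (∈-allFin p))) (λ σ → cong (λ y → φ A y σ) (sym vq≡x))
  ...     | inj₂ refl =
    inSpan-resp (inSpan-sum (λ p → generator ((A , v) , p)) (λ p → generator-inSpan (∈-cartesianProduct⁺ mA (∈-allFin p))))
                last-is-sum
    where
    last-is-sum : ∀ σ → φ A x σ ≡ sum (λ p → φ A (lookup v (inject₁ p)) σ)
    last-is-sum σ = sym (xor-≡-false (begin
      sum (λ p → φ A (lookup v (inject₁ p)) σ) xor φ A x σ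
        ≡⟨ cong (λ y → sum (λ p → φ A (lookup v (inject₁ p)) σ) xor φ A y σ) (sym vq≡x) ⟩
      sum (λ p → φ A (lookup v (inject₁ p)) σ) xor φ A (lookup v (final k)) σ
        ≡⟨ sym (sum-init-last (λ q → φ A (lookup v q) σ)) ⟩
      sum (λ q → φ A (lookup v q) σ)
        ≡⟨ governing-relation k (bijection (enumerations-sound n I mA)) σ ⟩
      false ∎))

  indices-unique : Unique indices
  indices-unique = Unique.cartesianProduct⁺ (enumerations-unique n I) (Unique.allFin⁺ (suc k))

  gov-hasDim : HasDim (InGov n I) (length indices)
  gov-hasDim = hasDim-by-duality (InGov n I) basis basisPoint
    (λ j → generator-inGov (∈-lookup j))
    (λ j → generator-diag (∈-lookup j))
    (λ j j' e → unique-lookup-injective indices-unique j' j (generator-dual (∈-lookup j') (∈-lookup j) e))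
    (λ f (gs , f≈) → inSpan-resp (inSpan-sumMaps govGen φ-inSpan gs) f≈)

  length-indices : length indices ≡ (I ∸ 1) * (n C I)
  length-indices = begin
    length (cartesianProduct (enumerations n I) (allFin (suc k)))
      ≡⟨ length-cartesianProduct (enumerations n I) (allFin (suc k)) ⟩
    length (enumerations n I) * length (allFin (suc k))
      ≡⟨ cong₂ _*_ (length-enumerations n I) (length-tabulate {n = suc k} (λ j → j)) ⟩
    (n C I) * suc k
      ≡⟨ *-comm (n C I) (suc k) ⟩
    suc k * (n C I) ∎

proposition2p1 : (n i : ℕ) → 2 ≤ i → HasDim (InGov n i) ((i ∸ 1) * (n C i))
proposition2p1 n (suc (suc k)) (s≤s (s≤s _)) = subst (HasDim (InGov n I)) length-indices gov-hasDim
  where open GovBasis n k
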